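{- Let $q \colon X^* \to R$, let $t = \mathsf{hBR}_{\langle\,\rangle}(q)$, and let $s \in t$ (so $s \colon X^*$). Then for every $i \leq |s|$, writing $u_i = \langle s_0, \ldots, s_{i-1}\rangle$, \[ s \in \{ u_i * r \;:\; r \in \mathsf{hBR}_{u_i}(q_{u_i}) \}. \]
   Context: $X$ is a type with a default element $\mathbf{0}$, $R = \mathcal{P}(R')$ is the type of finite subsets of some type $R'$, and $\mathcal{P}(Y)$ denotes finite subsets of $Y$. For a finite sequence $s \colon X^*$, $|s|$ is its length, $s_j$ its $j$-th entry, $s^+ \colon X^{\mathbb{N}}$ its extension by infinitely many $\mathbf{0}$'s, $s*x$ appends $x$, and $u*r$ is concatenation. For $q \colon X^* \to R$ and $u \colon X^*$ (or $u = x \colon X$ viewed as a one-element sequence), $q_u(r) = q(u*r)$. Fix $\omega \colon X^{\mathbb{N}} \to \mathbb{N}$ and $\varepsilon \colon X^* \to ((X \to R) \to \mathcal{P}(X))$ (written $\varepsilon_s$). $\mathsf{hBR}_s(q) \in \mathcal{P}(X^*)$, for $s \colon X^*$ and $q \colon X^* \to R$, is a functional satisfying for all $s,q$: $\mathsf{hBR}_s(q) = \{\langle\,\rangle\}$ if $\omega(s^+) < |s|$, and otherwise $\mathsf{hBR}_s(q) = \{ a * r : a \in \chi,\ r \in \mathsf{hBR}_{s*a}(q_a)\}$ where $\chi = \varepsilon_s\big(\lambda x . \bigcup\{ q_x(r) : r \in \mathsf{hBR}_{s*x}(q_x)\}\big)$. -}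

module Defs where

open import Data.Nat using (ℕ; zero; suc; _<_)
open import Data.List using (List; []; _∷_; _++_; [_]; concatMap; length)
open import Data.List.Membership.Propositional using (_∈_)
open import Data.Product using (Σ; _×_; _,_)
open import Relation.Nullary using (¬_)
open import Relation.Binary.PropositionalEquality using (_≡_)
open import Function.Bundles using (_⇔_)

-- Finite subsets 𝒫(Y) are represented by lists; two finite sets are equal
-- when they have the same members.
𝒫 : Set → Set
𝒫 Y = List Y

_≈ₛ_ : {Y : Set} → 𝒫 Y → 𝒫 Y → Set
A ≈ₛ B = ∀ y → (y ∈ A) ⇔ (y ∈ B)

ext : {X : Set} → X → List X → ℕ → X
ext 𝟎 []       n       = 𝟎
ext 𝟎 (x ∷ s)  zero    = x
ext 𝟎 (x ∷ s)  (suc n) = ext 𝟎 s n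

_*₁_ : {X : Set} → List X → X → List X
s *₁ x = s ++ [ x ]

shift : {X R : Set} → (List X → R) → List X → (List X → R)
shift q u r = q (u ++ r)

chi : {X R' : Set}
    → (ε : List X → (X → 𝒫 R') → 𝒫 X)
    → (hBR : List X → (List X → 𝒫 R') → 𝒫 (List X))
    → List X → (List X → 𝒫 R') → 𝒫 X
chi ε hBR s q =
  ε s (λ x → concatMap (λ r → shift q [ x ] r) (hBR (s *₁ x) (shift q [ x ])))

InStep : {X R' : Set}
       → (ε : List X → (X → 𝒫 R') → 𝒫 X)
       → (hBR : List X → (List X → 𝒫 R') → 𝒫 (List X))
       → List X → (List X → 𝒫 R') → List X → Set
InStep ε hBR s q w =
  Σ _ λ a → Σ _ λ r →
    (a ∈ chi ε hBR s q) × (r ∈ hBR (s *₁ a) (shift q [ a ])) × (w ≡ a ∷ r)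

IsHBR : {X R' : Set} → X → (ω : (ℕ → X) → ℕ)
      → (ε : List X → (X → 𝒫 R') → 𝒫 X)
      → (hBR : List X → (List X → 𝒫 R') → 𝒫 (List X)) → Set
IsHBR 𝟎 ω ε hBR =
  ∀ s q →
    (ω (ext 𝟎 s) < length s → hBR s q ≈ₛ [ [] ])
  × (¬ (ω (ext 𝟎 s) < length s) →
       ∀ w → (w ∈ hBR s q) ⇔ InStep ε hBR s q w)

module Submission where

-- The defining equations of hBR give a one-step fact: if a * r is a member
-- of hBR_v(F), then v is not a leaf (leaves only contain ⟨⟩), so the
-- recursive clause applies and r is a member of hBR_{v*a}(F_a).
-- Iterating this along an arbitrary finite prefix u, by induction on u,
-- shows that u * r ∈ hBR_v(F) implies r ∈ hBR_{v*u}(F_u).  The theorem is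
-- the instance v = ⟨⟩, F = q, u = take i s, r = drop i s, since
-- s = take i s * drop i s.

open import Defs
open import Data.Nat using (ℕ; _≤_; _<?_)
open import Data.List using (List; []; _∷_; _++_; [_]; take; drop; length)
open import Data.List.Properties using (++-identityʳ; ++-assoc; take++drop≡id)
open import Data.List.Membership.Propositional using (_∈_)
open import Data.List.Relation.Unary.Any using (here; there)
open import Data.Product using (Σ; _×_; _,_; proj₁; proj₂)
open import Relation.Binary.PropositionalEquality using (_≡_; refl; sym; subst)
open import Relation.Nullary using (yes; no)
open import Function.Bundles using (Equivalence)

module _ {X R' : Set} (𝟎 : X) (ω : (ℕ → X) → ℕ)
    (ε : List X → (X → 𝒫 R') → 𝒫 X)
    (hBR : List X → (List X → 𝒫 R') → 𝒫 (List X))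
    (isHBR : IsHBR 𝟎 ω ε hBR) where

  tail-∈ : ∀ v F a r → (a ∷ r) ∈ hBR v F → r ∈ hBR (v *₁ a) (shift F [ a ])
  tail-∈ v F a r a∷r∈ with ω (ext 𝟎 v) <? length v
  ... | yes leaf with Equivalence.to (proj₁ (isHBR v F) leaf (a ∷ r)) a∷r∈
  ...   | here ()
  ...   | there ()
  tail-∈ v F a r a∷r∈ | no notLeaf
    with Equivalence.to (proj₂ (isHBR v F) notLeaf (a ∷ r)) a∷r∈
  ... | _ , _ , _ , r∈ , refl = r∈

  suffix-∈ : ∀ v F u r → (u ++ r) ∈ hBR v F → r ∈ hBR (v ++ u) (shift F u)
  suffix-∈ v F [] r r∈ = subst (λ w → r ∈ hBR w F) (sym (++-identityʳ v)) r∈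
  suffix-∈ v F (a ∷ u) r a∷u++r∈ =
    subst (λ w → r ∈ hBR w (shift F (a ∷ u))) (++-assoc v [ a ] u)
      (suffix-∈ (v *₁ a) (shift F [ a ]) u r (tail-∈ v F a (u ++ r) a∷u++r∈))

lemma4p3 : {X R' : Set} (𝟎 : X) (ω : (ℕ → X) → ℕ)
    (ε : List X → (X → 𝒫 R') → 𝒫 X)
    (hBR : List X → (List X → 𝒫 R') → 𝒫 (List X))
    → IsHBR 𝟎 ω ε hBR
    → (q : List X → 𝒫 R') (s : List X)
    → s ∈ hBR [] q
    → (i : ℕ) → i ≤ length s
    → Σ (List X) λ r → (r ∈ hBR (take i s) (shift q (take i s))) × (s ≡ take i s ++ r)
lemma4p3 𝟎 ω ε hBR isHBR q s s∈t i _ =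
  drop i s , suffix-∈ 𝟎 ω ε hBR isHBR [] q (take i s) (drop i s) split∈t , sym split
  where
    split : take i s ++ drop i s ≡ s
    split = take++drop≡id i s

    split∈t : (take i s ++ drop i s) ∈ hBR [] q
    split∈t = subst (_∈ hBR [] q) (sym split) s∈t
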